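{- Let $G=(V,E)$ be a directed graph, let $s\in V$, and fix an arbitrary total order on $V$. Give each vertex $\overline x$ of $G'_s$ the order of its twin $x$. Then there is a one-to-one correspondence between the following two sets: (a) the set of $(s,t)$-bubbles of $G$, taken over all $t\in V$; (b) the set of cycles $C$ of $G'_s$ that pass through $s$, contain exactly two pairs of twin vertices, and whose swap predecessor is greater than its swap successor.
   Context: Graphs are simple: there are no self-loops and no multiple arcs. For $s\neq t$, an $(s,t)$-bubble of $G$ is an unordered pair of two distinct directed simple $s$-to-$t$ paths that share no vertex other than $s$ and $t$. The graph $G'_s$ has vertex set $\{v,\overline v: v\in V\}$, where $\overline v$ is called the twin of $v$. Its arc set is $\{(u,v),(\overline v,\overline u):(u,v)\in E,\ v\neq s\}\cup\{(v,\overline v): v\in V, v\neq s\}\cup\{(\overline s,s)\}$. A cycle $C$ of $G'_s$ through $s$ contains exactly one arc of the form $(t,\overline t)$ with $t\in V$. The swap predecessor of $C$ is the vertex preceding $t$ on $C$, and the swap successor of $C$ is the vertex following $\overline t$ on $C$. -}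

module Defs where

open import Level using (0ℓ)
open import Data.Nat using (ℕ)
open import Data.Fin using (Fin)
open import Data.Sum using (_⊎_; inj₁; inj₂; [_,_])
open import Data.Product using (Σ; ∃; ∃-syntax; _×_; _,_; proj₁; proj₂)
open import Data.Maybe using (just)
open import Data.List using (List; []; _∷_; _++_; head; last)
open import Data.List.Membership.Propositional using (_∈_)
open import Data.List.Relation.Unary.Unique.Propositional using (Unique)
open import Data.List.Relation.Unary.Linked using (Linked)
open import Relation.Binary using (Rel; Setoid; IsEquivalence; IsStrictTotalOrder)
open import Relation.Binary.PropositionalEquality using (_≡_; _≢_; refl; sym; trans)
open import Relation.Nullary using (¬_)
open import Function using (id)

-- Vertex set V = Fin n; a (simple) directed graph is an irreflexive arc relation
-- (a relation cannot have multiple arcs).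
Graph : ℕ → Set₁
Graph n = Rel (Fin n) 0ℓ

NoSelfLoops : ∀ {n} → Graph n → Set
NoSelfLoops {n} E = (v : Fin n) → ¬ E v v

IsPath : ∀ {n} → Graph n → Fin n → Fin n → List (Fin n) → Set
IsPath E s t P = head P ≡ just s × last P ≡ just t × Unique P × Linked E P

record Bubble {n} (E : Graph n) (s : Fin n) : Set where
  field
    t      : Fin n
    s≢t    : s ≢ t
    P Q    : List (Fin n)
    pathP  : IsPath E s t P
    pathQ  : IsPath E s t Q
    P≢Q    : P ≢ Q
    disj   : (v : Fin n) → v ∈ P → v ∈ Q → v ≡ s ⊎ v ≡ t

-- Bubbles are unordered pairs of paths: equal iff the pairs agree up to swap.
_≈B_ : ∀ {n} {E : Graph n} {s : Fin n} → Rel (Bubble E s) 0ℓ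
b ≈B b' = (P b ≡ P b' × Q b ≡ Q b') ⊎ (P b ≡ Q b' × Q b ≡ P b')
  where open Bubble

≈B-isEquivalence : ∀ {n} {E : Graph n} {s : Fin n} → IsEquivalence (_≈B_ {n} {E} {s})
≈B-isEquivalence = record
  { refl  = inj₁ (refl , refl)
  ; sym   = λ { (inj₁ (p , q)) → inj₁ (sym p , sym q)
              ; (inj₂ (p , q)) → inj₂ (sym q , sym p) }
  ; trans = λ { (inj₁ (p , q)) (inj₁ (p' , q')) → inj₁ (trans p p' , trans q q')
              ; (inj₁ (p , q)) (inj₂ (p' , q')) → inj₂ (trans p p' , trans q q')
              ; (inj₂ (p , q)) (inj₁ (p' , q')) → inj₂ (trans p q' , trans q p')
              ; (inj₂ (p , q)) (inj₂ (p' , q')) → inj₁ (trans p q' , trans q p') }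
  }

BubbleSetoid : ∀ {n} → Graph n → Fin n → Setoid 0ℓ 0ℓ
BubbleSetoid E s = record
  { Carrier = Bubble E s ; _≈_ = _≈B_ ; isEquivalence = ≈B-isEquivalence }

-- The graph G'_s: inj₁ v is v, inj₂ v is its twin v̄.
V' : ℕ → Set
V' n = Fin n ⊎ Fin n

twinBase : ∀ {n} → V' n → Fin n
twinBase = [ id , id ]

G'_ : ∀ {n} → Graph n → Fin n → Rel (V' n) 0ℓ
G'_ E s (inj₁ u) (inj₁ v) = E u v × v ≢ s
G'_ E s (inj₂ v) (inj₂ u) = E u v × v ≢ s           -- (v̄,ū), (u,v) ∈ E, v ≠ s
G'_ E s (inj₁ u) (inj₂ v) = u ≡ v × v ≢ s           -- (v,v̄), v ≠ s
G'_ E s (inj₂ u) (inj₁ v) = u ≡ s × v ≡ s           -- (s̄,s)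

IsCycleThrough : ∀ {n} → Rel (V' n) 0ℓ → V' n → List (V' n) → Set
IsCycleThrough E' x0 C =
  head C ≡ just x0 × Unique C × Linked E' C × ∃[ x ] (last C ≡ just x × E' x x0)

Consec : ∀ {A : Set} → List A → A → A → Set
Consec C x y = (∃[ l₁ ] ∃[ l₂ ] C ≡ l₁ ++ x ∷ y ∷ l₂) ⊎ (last C ≡ just x × head C ≡ just y)

ExactlyTwoTwinPairs : ∀ {n} → List (V' n) → Set
ExactlyTwoTwinPairs {n} C =
  ∃[ a ] ∃[ b ] (a ≢ b ×
    ((v : Fin n) → ((inj₁ v ∈ C × inj₂ v ∈ C) → (v ≡ a ⊎ v ≡ b))
                 × ((v ≡ a ⊎ v ≡ b) → (inj₁ v ∈ C × inj₂ v ∈ C))))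

-- Swap predecessor p (before t) is greater than swap successor q (after t̄),
-- where vertices of G'_s are compared by the order of their twin base.
SwapPredGreater : ∀ {n} → Rel (Fin n) 0ℓ → List (V' n) → Set
SwapPredGreater {n} _<_ C =
  ∃[ t ] ∃[ p ] ∃[ q ] (Consec C (inj₁ t) (inj₂ t) × Consec C p (inj₁ t)
                        × Consec C (inj₂ t) q × twinBase q < twinBase p)

-- The set (b), with cycles identified by their vertex sequence starting at s.
CycleSetoid : ∀ {n} → Graph n → Rel (Fin n) 0ℓ → Fin n → Setoid 0ℓ 0ℓ
CycleSetoid {n} E _<_ s = record
  { Carrier = Σ (List (V' n)) (λ C → IsCycleThrough (G'_ E s) (inj₁ s) C
                                   × ExactlyTwoTwinPairs C × SwapPredGreater _<_ C)
  ; _≈_ = λ c c' → proj₁ c ≡ proj₁ c'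
  ; isEquivalence = record { refl = refl ; sym = sym ; trans = trans }
  }

module Submission where

-- A bubble {P, Q} ending at t becomes the cycle that follows P from s to t, crosses to t̄,
-- follows the twins of Q backwards to s̄ and closes with s̄ → s. Its swap predecessor and
-- swap successor are the penultimate vertices of P and Q; these differ because P and Q are
-- distinct and internally disjoint, so exactly one of the two orientations of the bubble
-- meets the order condition. Conversely, a cycle through s can enter the barred copy only
-- along an arc t → t̄ and leave it only along s̄ → s, so it splits into two s-t paths, and
-- its twin pairs are precisely the common vertices of those paths.

open import Defs

open import Level using (Level; _⊔_; 0ℓ)
open import Data.Nat using (ℕ)
open import Data.Fin using (Fin)
open import Data.Empty using (⊥; ⊥-elim)
open import Data.Sum using (_⊎_; inj₁; inj₂)
open import Data.Sum.Properties using (inj₁-injective; inj₂-injective)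
open import Data.Product using (Σ; ∃; ∃₂; ∃-syntax; _×_; _,_; proj₁; proj₂; uncurry; swap)
open import Data.Product.Relation.Binary.Pointwise.NonDependent using (≡⇒≡×≡)
open import Data.Maybe using (Maybe; just)
import Data.Maybe as Maybe
open import Data.Maybe.Properties using (just-injective; map-injective)
open import Data.Maybe.Relation.Binary.Connected using (Connected; just)
open import Data.List using (List; []; _∷_; _++_; _∷ʳ_; map; head; last; reverse)
open import Data.List.Properties
  using (++-assoc; map-++; ∷-injective; ∷ʳ-injective; ∷ʳ-++; ++-conicalʳ;
         unfold-reverse; reverse-++; reverse-involutive; reverse-injective; head-map; last-map)
open import Data.List.Membership.Propositional using (_∈_; _∉_)
open import Data.List.Membership.Propositional.Properties
  using (∈-++⁺ˡ; ∈-++⁺ʳ; ∈-++⁻; ∈-map⁺; ∈-map⁻)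
open import Data.List.Relation.Unary.Any using (here; there)
open import Data.List.Relation.Unary.Any.Properties using (reverse⁺; reverse⁻)
import Data.List.Relation.Unary.All.Properties as All
open import Data.List.Relation.Unary.AllPairs using (_∷_)
open import Data.List.Relation.Unary.Unique.Propositional using (Unique; [])
import Data.List.Relation.Unary.Unique.Propositional.Properties as Unique
open import Data.List.Relation.Unary.Linked using (Linked; []; [-]; _∷_)
import Data.List.Relation.Unary.Linked as Linked
import Data.List.Relation.Unary.Linked.Properties as Linked
open import Data.List.Relation.Binary.Permutation.Propositional using (↭-sym; ↭⇒↭ₛ′)
open import Data.List.Relation.Binary.Permutation.Propositional.Properties using (↭-reverse)
import Data.List.Relation.Binary.Permutation.Setoid.Properties as Permutation
open import Function using (_∘_; flip)
open import Function.Bundles using (Bijection; _⇔_; mk⇔; Equivalence)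
open import Relation.Binary using (Rel; IsStrictTotalOrder; tri<; tri≈; tri>)
open import Relation.Binary.PropositionalEquality
  using (_≡_; _≢_; refl; sym; trans; cong; cong₂; subst; subst₂; setoid; isEquivalence)

private
  variable
    a b r ℓ : Level
    A : Set a
    B : Set b
    R : Rel A r
    x y : A
    xs ys : List A

last-++-∷ : ∀ (xs : List A) → last (xs ++ y ∷ ys) ≡ last (y ∷ ys)
last-++-∷ []           = refl
last-++-∷ (_ ∷ [])     = refl
last-++-∷ (_ ∷ x ∷ xs) = last-++-∷ (x ∷ xs)

last-reverse : ∀ (xs : List A) → last (reverse xs) ≡ head xs
last-reverse []       = refl
last-reverse (x ∷ xs) = trans (cong last (unfold-reverse x xs)) (last-++-∷ (reverse xs))

head-reverse : ∀ (xs : List A) → head (reverse xs) ≡ last xs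
head-reverse xs = trans (sym (last-reverse (reverse xs))) (cong last (reverse-involutive xs))

last-++ʳ : ∀ (xs : List A) → last ys ≡ just y → last (xs ++ ys) ≡ just y
last-++ʳ {ys = _ ∷ _} xs eq = trans (last-++-∷ xs) eq

head⇒∈ : head xs ≡ just x → x ∈ xs
head⇒∈ {xs = _ ∷ _} refl = here refl

last⇒∈ : last xs ≡ just x → x ∈ xs
last⇒∈ {xs = _ ∷ []}    refl = here refl
last⇒∈ {xs = _ ∷ _ ∷ _} eq   = there (last⇒∈ eq)

-- The default is returned for lists with fewer than two elements.
penultimate : A → List A → A
penultimate d []           = d
penultimate d (_ ∷ [])     = d
penultimate _ (x ∷ y ∷ xs) = penultimate x (y ∷ xs)

penultimate-++ : ∀ {d x y : A} xs → penultimate d (xs ++ x ∷ y ∷ []) ≡ x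
penultimate-++ []           = refl
penultimate-++ (_ ∷ [])     = refl
penultimate-++ (_ ∷ x ∷ xs) = penultimate-++ (x ∷ xs)

split-last₂ : ∀ (x x′ : A) xs → last (x ∷ x′ ∷ xs) ≡ just y →
              ∃₂ λ ys z → x ∷ x′ ∷ xs ≡ ys ++ z ∷ y ∷ []
split-last₂ x x′ []        refl = [] , x , refl
split-last₂ x x′ (x″ ∷ xs) eq
  with ys , z , eq′ ← split-last₂ x′ x″ xs eq = x ∷ ys , z , cong (x ∷_) eq′

connected : ∀ {mx my : Maybe A} → mx ≡ just x → my ≡ just y → R x y → Connected R mx my
connected refl refl r = just r

Unique-reverse : ∀ {A : Set a} {xs : List A} → Unique xs → Unique (reverse xs)
Unique-reverse {A = A} {xs} =
  Permutation.Unique-resp-↭ (setoid A) (↭⇒↭ₛ′ isEquivalence (↭-sym (↭-reverse xs)))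

Unique-++⁻ : ∀ (xs : List A) → Unique (xs ++ ys) → Unique xs × Unique ys
Unique-++⁻ []       u          = [] , u
Unique-++⁻ (x ∷ xs) (x∉ ∷ u) with uxs , uys ← Unique-++⁻ xs u = All.++⁻ˡ xs x∉ ∷ uxs , uys

split-unique : ∀ (l₁ m₁ : List A) {l₂ m₂} → Unique (l₁ ++ x ∷ l₂) →
               l₁ ++ x ∷ l₂ ≡ m₁ ++ x ∷ m₂ → l₁ ≡ m₁ × l₂ ≡ m₂
split-unique []       []       _       refl = refl , refl
split-unique []       (_ ∷ m₁) u       eq   with refl , eq′ ← ∷-injective eq =
  ⊥-elim (Unique.Unique[x∷xs]⇒x∉xs u (subst (_ ∈_) (sym eq′) (∈-++⁺ʳ m₁ (here refl))))
split-unique (_ ∷ l₁) []       u       eq   with refl , _ ← ∷-injective eq =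
  ⊥-elim (Unique.Unique[x∷xs]⇒x∉xs u (∈-++⁺ʳ l₁ (here refl)))
split-unique (_ ∷ l₁) (_ ∷ m₁) (_ ∷ u) eq   with refl , eq′ ← ∷-injective eq
  with refl , refl ← split-unique l₁ m₁ u eq′ = refl , refl

prefix-of-head-occurrence : ∀ (xs : List A) → Unique (xs ++ x ∷ ys) →
                            head (xs ++ x ∷ ys) ≡ just x → xs ≡ []
prefix-of-head-occurrence []       _ _    = refl
prefix-of-head-occurrence (_ ∷ xs) u refl = ⊥-elim (Unique.Unique[x∷xs]⇒x∉xs u (∈-++⁺ʳ xs (here refl)))

Linked-reverse : Linked R xs → Linked (flip R) (reverse xs)
Linked-reverse []                             = []
Linked-reverse [-]                            = [-]
Linked-reverse {R = R} {xs = x ∷ y ∷ xs} (r ∷ l) =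
  subst (Linked (flip R)) (sym (unfold-reverse x (y ∷ xs)))
    (Linked.++⁺ (Linked-reverse l) (connected (last-reverse (y ∷ xs)) refl r) [-])

Linked-++⁻ : ∀ (xs : List A) → Linked R (xs ++ ys) → Linked R xs × Linked R ys
Linked-++⁻ []           l       = [] , l
Linked-++⁻ (_ ∷ [])     l       = [-] , Linked.tail l
Linked-++⁻ (_ ∷ _ ∷ xs) (r ∷ l) with lxs , lys ← Linked-++⁻ (_ ∷ xs) l = r ∷ lxs , lys

Consec-pred-unique : ∀ {A : Set} {C : List A} {x y x′} l₁ {l₂} →
                     Unique C → Consec C x y → C ≡ l₁ ++ x′ ∷ y ∷ l₂ → x ≡ x′
Consec-pred-unique {x = x} {x′ = x′} l₁ u (inj₁ (m₁ , m₂ , eq)) eq′ =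
  proj₂ (∷ʳ-injective m₁ l₁ (proj₁ (split-unique (m₁ ∷ʳ x) (l₁ ∷ʳ x′)
    (subst Unique (trans eq (sym (∷ʳ-++ m₁ x _))) u)
    (trans (∷ʳ-++ m₁ x _) (trans (sym eq) (trans eq′ (sym (∷ʳ-++ l₁ x′ _))))))))
Consec-pred-unique {C = _ ∷ _} {x′ = x′} l₁ u (inj₂ (_ , refl)) eq′
  with () ← ++-conicalʳ l₁ (x′ ∷ [])
              (sym (proj₁ (split-unique [] (l₁ ∷ʳ x′) u (trans eq′ (sym (∷ʳ-++ l₁ x′ _))))))

Consec-succ-unique : ∀ {A : Set} {C : List A} {x y y′} l₁ {l₂} →
                     Unique C → Consec C x y → C ≡ l₁ ++ x ∷ y′ ∷ l₂ → y ≡ y′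
Consec-succ-unique l₁ u (inj₁ (m₁ , m₂ , eq)) eq′ =
  proj₁ (∷-injective (proj₂ (split-unique m₁ l₁ (subst Unique eq u) (trans (sym eq) eq′))))
Consec-succ-unique l₁ u (inj₂ (lastC , _)) refl =
  ⊥-elim (Unique.Unique[x∷xs]⇒x∉xs (proj₂ (Unique-++⁻ l₁ u))
           (last⇒∈ (trans (sym (last-++-∷ l₁)) lastC)))

infixr 5 _⊕_

_⊕_ : List A → List B → List (A ⊎ B)
X ⊕ Y = map inj₁ X ++ map inj₂ Y

map-inj₂-injective : ∀ (Y Y′ : List B) → map (inj₂ {A = A}) Y ≡ map inj₂ Y′ → Y ≡ Y′
map-inj₂-injective []      []       refl = refl
map-inj₂-injective (_ ∷ Y) (_ ∷ Y′) eq
  with refl , eq′ ← ∷-injective eq = cong (_ ∷_) (map-inj₂-injective Y Y′ eq′)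

⊕-injective : ∀ (X X′ : List A) {Y Y′ : List B} → X ⊕ Y ≡ X′ ⊕ Y′ → X ≡ X′ × Y ≡ Y′
⊕-injective []      []       eq = refl , map-inj₂-injective _ _ eq
⊕-injective []      (_ ∷ _)  {_ ∷ _} ()
⊕-injective (_ ∷ _) []       {Y′ = _ ∷ _} ()
⊕-injective (_ ∷ X) (_ ∷ X′) eq
  with refl , eq′ ← ∷-injective eq with refl , refl ← ⊕-injective X X′ eq′ = refl , refl

∈-⊕⁻ˡ : ∀ (X : List A) {Y : List B} → inj₁ x ∈ X ⊕ Y → x ∈ X
∈-⊕⁻ˡ X m with ∈-++⁻ (map inj₁ X) m
... | inj₁ m₁ with _ , m , refl ← ∈-map⁻ inj₁ m₁ = m
... | inj₂ m₂ with _ , _ , () ← ∈-map⁻ inj₂ m₂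

∈-⊕⁻ʳ : ∀ (X : List A) {Y : List B} → inj₂ y ∈ X ⊕ Y → y ∈ Y
∈-⊕⁻ʳ X m with ∈-++⁻ (map inj₁ X) m
... | inj₁ m₁ with _ , _ , () ← ∈-map⁻ inj₁ m₁
... | inj₂ m₂ with _ , m , refl ← ∈-map⁻ inj₂ m₂ = m

∈-⊕⁺ˡ : ∀ {X : List A} (Y : List B) → x ∈ X → inj₁ x ∈ X ⊕ Y
∈-⊕⁺ˡ Y = ∈-++⁺ˡ ∘ ∈-map⁺ inj₁

∈-⊕⁺ʳ : ∀ (X : List A) {Y : List B} → y ∈ Y → inj₂ y ∈ X ⊕ Y
∈-⊕⁺ʳ X = ∈-++⁺ʳ (map inj₁ X) ∘ ∈-map⁺ inj₂

Unique-⊕⁺ : ∀ {X : List A} {Y : List B} → Unique X → Unique Y → Unique (X ⊕ Y)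
Unique-⊕⁺ {X = X} {Y} uX uY =
  Unique.++⁺ (Unique.map⁺ inj₁-injective uX) (Unique.map⁺ inj₂-injective uY) disjoint
  where
  disjoint : ∀ {v} → v ∈ map inj₁ X × v ∈ map inj₂ Y → ⊥
  disjoint (m₁ , m₂) with _ , _ , refl ← ∈-map⁻ inj₁ m₁ with _ , _ , () ← ∈-map⁻ inj₂ m₂

Unique-⊕⁻ : ∀ (X : List A) {Y : List B} → Unique (X ⊕ Y) → Unique X × Unique Y
Unique-⊕⁻ X u with uX , uY ← Unique-++⁻ (map inj₁ X) u = Unique.map⁻ uX , Unique.map⁻ uY

⊕-switch : ∀ {A B : Set} {x : A} {y : B} X {Y} → Consec (X ⊕ Y) (inj₁ x) (inj₂ y) → last X ≡ just x
⊕-switch {A} {B} {x} {y} X {Y} (inj₁ (l₁ , l₂ , eq)) = go X l₁ eq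
  where
  go : ∀ (X : List A) l₁ → X ⊕ Y ≡ l₁ ++ inj₁ x ∷ inj₂ y ∷ l₂ → last X ≡ just x
  go []            l₁       eq with () ← ∈-⊕⁻ˡ [] (subst (_ ∈_) (sym eq) (∈-++⁺ʳ l₁ (here refl)))
  go (_ ∷ [])      []       eq with refl , _ ← ∷-injective eq = refl
  go (_ ∷ _ ∷ _)   []       eq with () ← proj₁ (∷-injective (proj₂ (∷-injective eq)))
  go (_ ∷ [])      (_ ∷ l₁) eq with () ← go [] l₁ (proj₂ (∷-injective eq))
  go (_ ∷ x ∷ X)   (_ ∷ l₁) eq = go (x ∷ X) l₁ (proj₂ (∷-injective eq))
⊕-switch []      {Y} (inj₂ (lastE , _)) with () ← ∈-⊕⁻ˡ [] {Y} (last⇒∈ lastE)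
⊕-switch (_ ∷ _) (inj₂ (_ , ()))

ExactlyTwo : {A : Set a} → (A → Set ℓ) → Set (a ⊔ ℓ)
ExactlyTwo {A = A} T =
  ∃[ u ] ∃[ w ] (u ≢ w × ((v : A) → (T v → v ≡ u ⊎ v ≡ w) × (v ≡ u ⊎ v ≡ w → T v)))

module _ {A : Set a} {T : A → Set ℓ} {u w : A} where

  exactlyTwo-intro : T u → T w → u ≢ w → (∀ v → T v → v ≡ u ⊎ v ≡ w) → ExactlyTwo T
  exactlyTwo-intro Tu Tw u≢w only =
    u , w , u≢w , λ v → only v , λ { (inj₁ refl) → Tu ; (inj₂ refl) → Tw }

  exactlyTwo-elim : ExactlyTwo T → T u → T w → u ≢ w → ∀ {v} → T v → v ≡ u ⊎ v ≡ w
  exactlyTwo-elim (_ , _ , _ , spec) Tu Tw u≢w {v} Tv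
    with proj₁ (spec u) Tu | proj₁ (spec w) Tw | proj₁ (spec v) Tv
  ... | inj₁ refl | inj₁ refl | _         = ⊥-elim (u≢w refl)
  ... | inj₂ refl | inj₂ refl | _         = ⊥-elim (u≢w refl)
  ... | inj₁ refl | inj₂ refl | inj₁ refl = inj₁ refl
  ... | inj₁ refl | inj₂ refl | inj₂ refl = inj₂ refl
  ... | inj₂ refl | inj₁ refl | inj₁ refl = inj₂ refl
  ... | inj₂ refl | inj₁ refl | inj₂ refl = inj₁ refl

-- Ordering a pair by a key into a strict total order, larger key first

module SortPair {A : Set a} {B : Set b} {_<_ : Rel B r} (sto : IsStrictTotalOrder _≡_ _<_) (key : A → B) where

  open IsStrictTotalOrder sto using (compare; asym)

  sortPair : A → A → A × A
  sortPair x y with compare (key x) (key y)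
  ... | tri< _ _ _ = y , x
  ... | tri≈ _ _ _ = x , y
  ... | tri> _ _ _ = x , y

  module _ {x y : A} where

    sortPair-sorted : key y < key x → sortPair x y ≡ (x , y)
    sortPair-sorted y<x with compare (key x) (key y)
    ... | tri< x<y _ _ = ⊥-elim (asym x<y y<x)
    ... | tri≈ _ _ _   = refl
    ... | tri> _ _ _   = refl

    sortPair-unsorted : key x < key y → sortPair x y ≡ (y , x)
    sortPair-unsorted x<y with compare (key x) (key y)
    ... | tri< _ _ _   = refl
    ... | tri≈ x≮y _ _ = ⊥-elim (x≮y x<y)
    ... | tri> _ _ y<x = ⊥-elim (asym x<y y<x)

    sortPair-cases : key x ≢ key y →
                     (sortPair x y ≡ (x , y) × key y < key x) ⊎ (sortPair x y ≡ (y , x) × key x < key y)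
    sortPair-cases kx≢ky with compare (key x) (key y)
    ... | tri< x<y _ _ = inj₂ (refl , x<y)
    ... | tri≈ _ kx≡ky _ = ⊥-elim (kx≢ky kx≡ky)
    ... | tri> _ _ y<x = inj₁ (refl , y<x)

  sortPair-comm : ∀ {x y} → key x ≢ key y → sortPair x y ≡ sortPair y x
  sortPair-comm kx≢ky with sortPair-cases kx≢ky
  ... | inj₁ (eq , y<x) = trans eq (sym (sortPair-unsorted y<x))
  ... | inj₂ (eq , x<y) = trans eq (sym (sortPair-sorted x<y))

  sortPair-injective : ∀ {x y x′ y′} → key x ≢ key y → key x′ ≢ key y′ → sortPair x y ≡ sortPair x′ y′ →
                       (x ≡ x′ × y ≡ y′) ⊎ (x ≡ y′ × y ≡ x′)
  sortPair-injective kx≢ky kx′≢ky′ eq with sortPair-cases kx≢ky | sortPair-cases kx′≢ky′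
  ... | inj₁ (e , _) | inj₁ (e′ , _) = inj₁ (≡⇒≡×≡ (trans (sym e) (trans eq e′)))
  ... | inj₁ (e , _) | inj₂ (e′ , _) = inj₂ (≡⇒≡×≡ (trans (sym e) (trans eq e′)))
  ... | inj₂ (e , _) | inj₁ (e′ , _) = inj₂ (swap (≡⇒≡×≡ (trans (sym e) (trans eq e′))))
  ... | inj₂ (e , _) | inj₂ (e′ , _) = inj₁ (swap (≡⇒≡×≡ (trans (sym e) (trans eq e′))))

-- Bubbles of G and cycles of G′ₛ

module BubbleCycles {n : ℕ} (E : Graph n) (s : Fin n) where

  G′ : Rel (V' n) 0ℓ
  G′ = G'_ E s

  -- G′ joins unbarred vertices along Eₛ and barred ones along flip Eₛ.
  Eₛ : Rel (Fin n) 0ℓ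
  Eₛ u v = E u v × v ≢ s

  InternallyDisjoint : Fin n → List (Fin n) → List (Fin n) → Set
  InternallyDisjoint t P Q = (v : Fin n) → v ∈ P → v ∈ Q → v ≡ s ⊎ v ≡ t

  TwinPair : List (V' n) → Fin n → Set
  TwinPair C v = inj₁ v ∈ C × inj₂ v ∈ C

  cycleOf : List (Fin n) × List (Fin n) → List (V' n)
  cycleOf (P , Q) = P ⊕ reverse Q

  private
    variable
      t v : Fin n
      P Q : List (Fin n)
      C : List (V' n)

  Linked-Eₛ : s ∉ xs → Linked E (x ∷ xs) → Linked Eₛ (x ∷ xs)
  Linked-Eₛ _  [-]     = [-]
  Linked-Eₛ s∉ (r ∷ l) = (r , λ eq → s∉ (here (sym eq))) ∷ Linked-Eₛ (s∉ ∘ there) l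

  path⇒Linked-Eₛ : IsPath E s t P → Linked Eₛ P
  path⇒Linked-Eₛ {P = _ ∷ _} (refl , _ , u , l) = Linked-Eₛ (Unique.Unique[x∷xs]⇒x∉xs u) l

  path-split : s ≢ t → IsPath E s t P → ∃₂ λ P₁ a → P ≡ P₁ ++ a ∷ t ∷ []
  path-split {P = _ ∷ []}      s≢t (refl , refl , _) = ⊥-elim (s≢t refl)
  path-split {P = x ∷ x′ ∷ xs} _   (_ , lastP , _)   = split-last₂ x x′ xs lastP

  twinPair-cycleOf⁺ : v ∈ P → v ∈ Q → TwinPair (cycleOf (P , Q)) v
  twinPair-cycleOf⁺ {Q = Q} v∈P v∈Q = ∈-⊕⁺ˡ (reverse Q) v∈P , ∈-⊕⁺ʳ _ (reverse⁺ v∈Q)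

  twinPair-cycleOf⁻ : TwinPair (cycleOf (P , Q)) v → v ∈ P × v ∈ Q
  twinPair-cycleOf⁻ {P = P} (m₁ , m₂) = ∈-⊕⁻ˡ P m₁ , reverse⁻ (∈-⊕⁻ʳ P m₂)

  cycleOf-injective : ∀ {p q} → cycleOf p ≡ cycleOf q → p ≡ q
  cycleOf-injective {P , _} {P′ , _} eq
    with refl , eq′ ← ⊕-injective P P′ eq = cong (P ,_) (reverse-injective eq′)

  cycleOf-around-swap : ∀ P₁ Q₁ {a b} → cycleOf (P₁ ++ a ∷ t ∷ [] , Q₁ ++ b ∷ t ∷ []) ≡
                        map inj₁ P₁ ++ inj₁ a ∷ inj₁ t ∷ inj₂ t ∷ inj₂ b ∷ map inj₂ (reverse Q₁)
  cycleOf-around-swap P₁ Q₁ {b = b} =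
    trans (cong₂ _++_ (map-++ inj₁ P₁ _) (cong (map inj₂) (reverse-++ Q₁ (b ∷ _ ∷ []))))
          (++-assoc (map inj₁ P₁) _ _)

  cycleOf-isCycle : s ≢ t → IsPath E s t P → IsPath E s t Q → IsCycleThrough G′ (inj₁ s) (cycleOf (P , Q))
  cycleOf-isCycle {P = P@(_ ∷ _)} {Q} s≢t pathP@(refl , lastP , uP , _) pathQ@(headQ , lastQ , uQ , _) =
    refl , Unique-⊕⁺ uP (Unique-reverse uQ) , linked , inj₂ s , lastC , refl , refl
    where
    junction : Connected G′ (last (map inj₁ P)) (head (map inj₂ (reverse Q)))
    junction = connected (trans (last-map inj₁ P) (cong (Maybe.map inj₁) lastP))
                         (trans (head-map (reverse Q)) (cong (Maybe.map inj₂) (trans (head-reverse Q) lastQ)))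
                         (refl , s≢t ∘ sym)
    linked : Linked G′ (cycleOf (P , Q))
    linked = Linked.++⁺ (Linked.map⁺ (path⇒Linked-Eₛ pathP)) junction
                        (Linked.map⁺ (Linked-reverse (path⇒Linked-Eₛ pathQ)))
    lastC : last (cycleOf (P , Q)) ≡ just (inj₂ s)
    lastC = last-++ʳ (map inj₁ P)
              (trans (last-map inj₂ (reverse Q)) (cong (Maybe.map inj₂) (trans (last-reverse Q) headQ)))

  arc-into-s : ∀ {x} → G′ x (inj₁ s) → x ≡ inj₂ s
  arc-into-s {inj₁ _} (_ , s≢s) = ⊥-elim (s≢s refl)
  arc-into-s {inj₂ _} (refl , _) = refl

  barredWalk : ∀ {w} l → Linked G′ (inj₂ w ∷ l) → inj₁ s ∉ l → ∃[ B ] l ≡ map inj₂ B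
  barredWalk []           _                _  = [] , refl
  barredWalk (inj₁ _ ∷ _) ((_ , refl) ∷ _) s∉ = ⊥-elim (s∉ (here refl))
  barredWalk (inj₂ u ∷ l) (_ ∷ linked)     s∉
    with B , refl ← barredWalk l linked (s∉ ∘ there) = u ∷ B , refl

  walk-split : ∀ {w} l → Linked G′ (inj₁ w ∷ l) → inj₁ s ∉ l → last (inj₁ w ∷ l) ≡ just (inj₂ s) →
               ∃[ A ] ∃[ t ] ∃[ B ] (inj₁ w ∷ l ≡ (w ∷ A) ⊕ (t ∷ B) × last (w ∷ A) ≡ just t × t ≢ s)
  walk-split []           _                         _  ()
  walk-split (inj₁ u ∷ l) (_ ∷ linked)              s∉ lastW
    with A , t , B , refl , lastA , t≢s ← walk-split l linked (s∉ ∘ there) lastW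
    = u ∷ A , t , B , refl , lastA , t≢s
  walk-split (inj₂ u ∷ l) ((refl , u≢s) ∷ linked) s∉ _
    with B , refl ← barredWalk l linked (s∉ ∘ there) = [] , u , B , refl , refl , u≢s

  isCycle⇒cycleOf : IsCycleThrough G′ (inj₁ s) C →
                    ∃[ t ] ∃₂ λ P Q → s ≢ t × IsPath E s t P × IsPath E s t Q × C ≡ cycleOf (P , Q)
  isCycle⇒cycleOf {C = _ ∷ l} (refl , u , linked , _ , lastC , arc) with refl ← arc-into-s arc
    with A , t , B , refl , lastP , t≢s ← walk-split l linked (Unique.Unique[x∷xs]⇒x∉xs u) lastC
    = t , s ∷ A , reverse (t ∷ B) , t≢s ∘ sym , pathP , pathQ
    , cong ((s ∷ A) ⊕_) (sym (reverse-involutive (t ∷ B)))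
    where
    uniqueP×B : Unique (s ∷ A) × Unique (t ∷ B)
    uniqueP×B = Unique-⊕⁻ (s ∷ A) u
    linkedP×B : Linked G′ (map inj₁ (s ∷ A)) × Linked G′ (map inj₂ (t ∷ B))
    linkedP×B = Linked-++⁻ (map inj₁ (s ∷ A)) linked
    pathP : IsPath E s t (s ∷ A)
    pathP = refl , lastP , proj₁ uniqueP×B , Linked.map proj₁ (Linked.map⁻ (proj₁ linkedP×B))
    lastB : last (t ∷ B) ≡ just s
    lastB = map-injective inj₂-injective
              (trans (sym (last-map inj₂ (t ∷ B))) (trans (sym (last-++-∷ (map inj₁ (s ∷ A)))) lastC))
    pathQ : IsPath E s t (reverse (t ∷ B))
    pathQ = trans (head-reverse (t ∷ B)) lastB , last-reverse (t ∷ B) , Unique-reverse (proj₂ uniqueP×B)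
          , Linked-reverse (Linked.map proj₁ (Linked.map⁻ (proj₂ linkedP×B)))

  exactlyTwoTwinPairs⇔ : s ≢ t → IsPath E s t P → IsPath E s t Q →
                         InternallyDisjoint t P Q ⇔ ExactlyTwoTwinPairs (cycleOf (P , Q))
  exactlyTwoTwinPairs⇔ {t} {P} {Q} s≢t (headP , lastP , _) (headQ , lastQ , _) = mk⇔
    (λ disj → exactlyTwo-intro twin-s twin-t s≢t λ v twin → uncurry (disj v) (twinPair-cycleOf⁻ twin))
    (λ two v v∈P v∈Q → exactlyTwo-elim two twin-s twin-t s≢t (twinPair-cycleOf⁺ v∈P v∈Q))
    where
    twin-s : TwinPair (cycleOf (P , Q)) s
    twin-s = twinPair-cycleOf⁺ {P = P} {Q} (head⇒∈ headP) (head⇒∈ headQ)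
    twin-t : TwinPair (cycleOf (P , Q)) t
    twin-t = twinPair-cycleOf⁺ {P = P} {Q} (last⇒∈ lastP) (last⇒∈ lastQ)

  module _ {_<_ : Rel (Fin n) 0ℓ} where

    swapPredGreater⁺ : ∀ P₁ Q₁ {a b} → b < a →
                       SwapPredGreater _<_ (cycleOf (P₁ ++ a ∷ t ∷ [] , Q₁ ++ b ∷ t ∷ []))
    swapPredGreater⁺ {t} P₁ Q₁ {a} {b} b<a = t , inj₁ a , inj₂ b , swapArc , predArc , succArc , b<a
      where
      cycle : List (V' n)
      cycle = cycleOf (P₁ ++ a ∷ t ∷ [] , Q₁ ++ b ∷ t ∷ [])
      M : List (V' n)
      M = map inj₁ P₁
      around : cycle ≡ M ++ inj₁ a ∷ inj₁ t ∷ inj₂ t ∷ inj₂ b ∷ map inj₂ (reverse Q₁)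
      around = cycleOf-around-swap P₁ Q₁
      swapArc : Consec cycle (inj₁ t) (inj₂ t)
      swapArc = inj₁ (M ∷ʳ inj₁ a , _ , trans around (sym (∷ʳ-++ M (inj₁ a) _)))
      predArc : Consec cycle (inj₁ a) (inj₁ t)
      predArc = inj₁ (M , _ , around)
      succArc : Consec cycle (inj₂ t) (inj₂ b)
      succArc = inj₁ (M ++ inj₁ a ∷ inj₁ t ∷ [] , _ , trans around (sym (++-assoc M _ _)))

    swapPredGreater⁻ : ∀ P₁ Q₁ {a b} → Unique (cycleOf (P₁ ++ a ∷ t ∷ [] , Q₁ ++ b ∷ t ∷ [])) →
                       SwapPredGreater _<_ (cycleOf (P₁ ++ a ∷ t ∷ [] , Q₁ ++ b ∷ t ∷ [])) → b < a
    swapPredGreater⁻ {t} P₁ Q₁ {a} u (_ , _ , _ , swapArc , predArc , succArc , q<p)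
      with refl ← just-injective (trans (sym (last-++-∷ P₁)) (⊕-switch (P₁ ++ a ∷ t ∷ []) swapArc))
      with refl ← Consec-pred-unique (map inj₁ P₁) u predArc (cycleOf-around-swap P₁ Q₁)
      with refl ← Consec-succ-unique (map inj₁ P₁ ++ inj₁ a ∷ inj₁ t ∷ []) u succArc
                    (trans (cycleOf-around-swap P₁ Q₁) (sym (++-assoc (map inj₁ P₁) _ _)))
      = q<p

    swapPredGreater⇔ : s ≢ t → IsPath E s t P → IsPath E s t Q →
                       penultimate s Q < penultimate s P ⇔ SwapPredGreater _<_ (cycleOf (P , Q))
    swapPredGreater⇔ s≢t pathP@(_ , _ , uP , _) pathQ@(_ , _ , uQ , _)
      with P₁ , _ , refl ← path-split s≢t pathP
      with Q₁ , _ , refl ← path-split s≢t pathQ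
      = mk⇔ (swapPredGreater⁺ P₁ Q₁ ∘ subst₂ _<_ (penultimate-++ Q₁) (penultimate-++ P₁))
            (subst₂ _<_ (sym (penultimate-++ Q₁)) (sym (penultimate-++ P₁)) ∘ swapPredGreater⁻ P₁ Q₁ uPQ)
      where
      uPQ : Unique (cycleOf (P₁ ++ _ ∷ _ ∷ [] , Q₁ ++ _ ∷ _ ∷ []))
      uPQ = Unique-⊕⁺ uP (Unique-reverse uQ)

  penultimate-distinct : s ≢ t → IsPath E s t P → IsPath E s t Q → InternallyDisjoint t P Q → P ≢ Q →
                         penultimate s P ≢ penultimate s Q
  penultimate-distinct s≢t pathP@(headP , _ , uP , _) pathQ@(headQ , _ , uQ , _) disj P≢Q eq
    with P₁ , a , refl ← path-split s≢t pathP
    with Q₁ , _ , refl ← path-split s≢t pathQ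
    with refl ← trans (sym (penultimate-++ P₁)) (trans eq (penultimate-++ Q₁))
    with disj a (∈-++⁺ʳ P₁ (here refl)) (∈-++⁺ʳ Q₁ (here refl))
  ... | inj₂ refl = Unique.Unique[x∷xs]⇒x∉xs (proj₂ (Unique-++⁻ P₁ uP)) (here refl)
  ... | inj₁ refl
    with refl ← prefix-of-head-occurrence P₁ uP headP
    with refl ← prefix-of-head-occurrence Q₁ uQ headQ
    = P≢Q refl

module Correspondence {n : ℕ} (E : Graph n) (s : Fin n)
                      {_<_ : Rel (Fin n) 0ℓ} (sto : IsStrictTotalOrder _≡_ _<_) where

  open BubbleCycles E s
  open SortPair sto (penultimate s)
  open IsStrictTotalOrder sto using (irrefl)
  open Bubble

  IsBubbleCycle : List (V' n) → Set
  IsBubbleCycle C = IsCycleThrough G′ (inj₁ s) C × ExactlyTwoTwinPairs C × SwapPredGreater _<_ C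

  swapPaths : Bubble E s → Bubble E s
  swapPaths b = record
    { t = t b ; s≢t = s≢t b ; P = Q b ; Q = P b ; pathP = pathQ b ; pathQ = pathP b
    ; P≢Q = P≢Q b ∘ sym ; disj = λ v v∈Q v∈P → disj b v v∈P v∈Q }

  bubble-penultimate-distinct : (b : Bubble E s) → penultimate s (P b) ≢ penultimate s (Q b)
  bubble-penultimate-distinct b = penultimate-distinct (s≢t b) (pathP b) (pathQ b) (disj b) (P≢Q b)

  bubbleCycle : (b : Bubble E s) → penultimate s (Q b) < penultimate s (P b) → IsBubbleCycle (cycleOf (P b , Q b))
  bubbleCycle b Q<P = cycleOf-isCycle (s≢t b) (pathP b) (pathQ b)
                    , Equivalence.to (exactlyTwoTwinPairs⇔ (s≢t b) (pathP b) (pathQ b)) (disj b)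
                    , Equivalence.to (swapPredGreater⇔ {_<_ = _<_} (s≢t b) (pathP b) (pathQ b)) Q<P

  sortedBubbleCycle : (b : Bubble E s) → IsBubbleCycle (cycleOf (sortPair (P b) (Q b)))
  sortedBubbleCycle b with sortPair-cases (bubble-penultimate-distinct b)
  ... | inj₁ (eq , Q<P) = subst (IsBubbleCycle ∘ cycleOf) (sym eq) (bubbleCycle b Q<P)
  ... | inj₂ (eq , P<Q) = subst (IsBubbleCycle ∘ cycleOf) (sym eq) (bubbleCycle (swapPaths b) P<Q)

  bubbleCycle⁻¹ : ∀ {C} → IsBubbleCycle C →
                  Σ (Bubble E s) λ b → penultimate s (Q b) < penultimate s (P b) × cycleOf (P b , Q b) ≡ C
  bubbleCycle⁻¹ (cycle , two , swap)
    with t , P , Q , s≢t , pathP , pathQ , refl ← isCycle⇒cycleOf cycle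
    = record { t = t ; s≢t = s≢t ; P = P ; Q = Q ; pathP = pathP ; pathQ = pathQ
             ; P≢Q = λ { refl → irrefl refl Q<P }
             ; disj = Equivalence.from (exactlyTwoTwinPairs⇔ s≢t pathP pathQ) two }
    , Q<P , refl
    where
    Q<P : penultimate s Q < penultimate s P
    Q<P = Equivalence.from (swapPredGreater⇔ {_<_ = _<_} s≢t pathP pathQ) swap

  toCycle : Bubble E s → Σ (List (V' n)) IsBubbleCycle
  toCycle b = cycleOf (sortPair (P b) (Q b)) , sortedBubbleCycle b

  toCycle-cong : ∀ {b b′} → b ≈B b′ → proj₁ (toCycle b) ≡ proj₁ (toCycle b′)
  toCycle-cong (inj₁ (P≡ , Q≡)) = cong cycleOf (cong₂ sortPair P≡ Q≡)
  toCycle-cong {b′ = b′} (inj₂ (P≡ , Q≡)) =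
    cong cycleOf (trans (cong₂ sortPair P≡ Q≡) (sortPair-comm (bubble-penultimate-distinct b′ ∘ sym)))

  toCycle-injective : ∀ {b b′} → proj₁ (toCycle b) ≡ proj₁ (toCycle b′) → b ≈B b′
  toCycle-injective {b} {b′} eq =
    sortPair-injective (bubble-penultimate-distinct b) (bubble-penultimate-distinct b′) (cycleOf-injective eq)

  toCycle-surjective : ∀ c → ∃ λ b → ∀ {b′} → b′ ≈B b → proj₁ (toCycle b′) ≡ proj₁ c
  toCycle-surjective (_ , isBubbleCycle) with b , Q<P , eq ← bubbleCycle⁻¹ isBubbleCycle =
    b , λ {b′} b′≈b → trans (toCycle-cong {b′} {b} b′≈b) (trans (cong cycleOf (sortPair-sorted Q<P)) eq)

-- Simple paths and cycles never use loops.
mainTheorem3 : (n : ℕ) (E : Graph n) → NoSelfLoops E → (s : Fin n)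
    → (_<_ : Rel (Fin n) 0ℓ) → IsStrictTotalOrder _≡_ _<_
    → Bijection (BubbleSetoid E s) (CycleSetoid E _<_ s)
mainTheorem3 n E _ s _<_ sto = record
  { to        = toCycle
  ; cong      = λ {b} {b′} → toCycle-cong {b} {b′}
  ; bijective = (λ {b} {b′} → toCycle-injective {b} {b′}) , toCycle-surjective
  }
  where open Correspondence E s sto
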